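{- Let $n\ge5$ and let $T$ be a $\Delta(1,2,2)$-free tournament with $n$ vertices. Suppose there is a vertex $x\in V(T)$ such that $T\setminus x$ is a paving tournament with paving ordering $\sigma=(v_1,\dots,v_{n-1})$. Then there exists $i\in[n-1]$ such that $x$ has at most one out-neighbour in $\{v_1,\dots,v_{i-1}\}$ and at most one in-neighbour in $\{v_{i+4},\dots,v_{n-1}\}$.
   Context: Tournaments are finite; $T$ is $S$-free if no induced subtournament is isomorphic to $S$. $X\Rightarrow Y$: all edges between disjoint $X,Y$ go from $X$ to $Y$. $\Delta(1,2,2)$: vertices $x,y_1,y_2,z_1,z_2$ with $x\Rightarrow\{y_1,y_2\}\Rightarrow\{z_1,z_2\}\Rightarrow x$ and edges $y_1y_2,z_1z_2$. For an ordering $\sigma=(v_1,\dots,v_m)$, $B_\sigma(T)$ is the undirected graph on the vertex set with edges $v_iv_j$ for $i>j$ and $v_iv_j$ an edge of the tournament. A paving ordering of a tournament is an ordering $\sigma=(v_1,\dots,v_m)$ such that $v_i,v_{i+1}$ are nonadjacent in $B_\sigma$ for all $i\in[m-1]$ and each $v_i$ has at most one $B_\sigma$-neighbour in $\{v_s:s<i\}$ and at most one in $\{v_t:t>i\}$; a paving tournament is one admitting a paving ordering. Sets $\{v_a,\dots,v_b\}$ with $a>b$ are empty. -}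

module Defs where

open import Data.Nat using (ℕ; suc; _≤_; _<_; _+_)
open import Data.Fin using (Fin; zero; suc; toℕ; punchIn)
open import Data.Fin.Properties using (punchIn-injective; punchInᵢ≢i)
open import Data.Bool using (Bool; true; false; not)
open import Data.Product using (Σ; ∃; _×_; _,_)
open import Data.Sum using (_⊎_)
open import Relation.Nullary using (¬_)
open import Relation.Binary.PropositionalEquality using (_≡_; _≢_; refl)
open import Function.Definitions using (Injective; Surjective)

-- A tournament on vertex set Fin n; adj u v ≡ true means the arc u → v.
record Tournament (n : ℕ) : Set where
  field
    adj     : Fin n → Fin n → Bool
    irrefl  : ∀ v → adj v v ≡ false
    tourn   : ∀ u v → u ≢ v → adj u v ≡ not (adj v u)

open Tournament public

Arc : ∀ {n} → Tournament n → Fin n → Fin n → Set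
Arc T u v = adj T u v ≡ true

-- S is an induced subtournament of T (up to isomorphism):
-- an injective vertex map preserving arcs and non-arcs.
record Embedding {m n : ℕ} (S : Tournament m) (T : Tournament n) : Set where
  field
    f      : Fin m → Fin n
    f-inj  : Injective _≡_ _≡_ f
    f-adj  : ∀ a b → adj T (f a) (f b) ≡ adj S a b

Free : ∀ {m n} → Tournament m → Tournament n → Set
Free S T = ¬ Embedding S T

-- Δ(1,2,2) on Fin 5 with labels 0 = x, 1 = y₁, 2 = y₂, 3 = z₁, 4 = z₂:
-- x ⇒ {y₁,y₂} ⇒ {z₁,z₂} ⇒ x, y₁ → y₂, z₁ → z₂.
Δ122-adj : Fin 5 → Fin 5 → Bool
Δ122-adj zero (suc zero) = true
Δ122-adj zero (suc (suc zero)) = true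
Δ122-adj (suc zero) (suc (suc zero)) = true
Δ122-adj (suc zero) (suc (suc (suc zero))) = true
Δ122-adj (suc zero) (suc (suc (suc (suc zero)))) = true
Δ122-adj (suc (suc zero)) (suc (suc (suc zero))) = true
Δ122-adj (suc (suc zero)) (suc (suc (suc (suc zero)))) = true
Δ122-adj (suc (suc (suc zero))) zero = true
Δ122-adj (suc (suc (suc (suc zero)))) zero = true
Δ122-adj (suc (suc (suc zero))) (suc (suc (suc (suc zero)))) = true
Δ122-adj _ _ = false

private
  Δ-irrefl : ∀ v → Δ122-adj v v ≡ false
  Δ-irrefl zero = refl
  Δ-irrefl (suc zero) = refl
  Δ-irrefl (suc (suc zero)) = refl
  Δ-irrefl (suc (suc (suc zero))) = refl
  Δ-irrefl (suc (suc (suc (suc zero)))) = refl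

  Δ-tourn : ∀ u v → u ≢ v → Δ122-adj u v ≡ not (Δ122-adj v u)
  Δ-tourn zero zero ne with () ← ne refl
  Δ-tourn zero (suc zero) _ = refl
  Δ-tourn zero (suc (suc zero)) _ = refl
  Δ-tourn zero (suc (suc (suc zero))) _ = refl
  Δ-tourn zero (suc (suc (suc (suc zero)))) _ = refl
  Δ-tourn (suc zero) zero _ = refl
  Δ-tourn (suc zero) (suc zero) ne with () ← ne refl
  Δ-tourn (suc zero) (suc (suc zero)) _ = refl
  Δ-tourn (suc zero) (suc (suc (suc zero))) _ = refl
  Δ-tourn (suc zero) (suc (suc (suc (suc zero)))) _ = refl
  Δ-tourn (suc (suc zero)) zero _ = refl
  Δ-tourn (suc (suc zero)) (suc zero) _ = refl
  Δ-tourn (suc (suc zero)) (suc (suc zero)) ne with () ← ne refl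
  Δ-tourn (suc (suc zero)) (suc (suc (suc zero))) _ = refl
  Δ-tourn (suc (suc zero)) (suc (suc (suc (suc zero)))) _ = refl
  Δ-tourn (suc (suc (suc zero))) zero _ = refl
  Δ-tourn (suc (suc (suc zero))) (suc zero) _ = refl
  Δ-tourn (suc (suc (suc zero))) (suc (suc zero)) _ = refl
  Δ-tourn (suc (suc (suc zero))) (suc (suc (suc zero))) ne with () ← ne refl
  Δ-tourn (suc (suc (suc zero))) (suc (suc (suc (suc zero)))) _ = refl
  Δ-tourn (suc (suc (suc (suc zero)))) zero _ = refl
  Δ-tourn (suc (suc (suc (suc zero)))) (suc zero) _ = refl
  Δ-tourn (suc (suc (suc (suc zero)))) (suc (suc zero)) _ = refl
  Δ-tourn (suc (suc (suc (suc zero)))) (suc (suc (suc zero))) _ = refl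
  Δ-tourn (suc (suc (suc (suc zero)))) (suc (suc (suc (suc zero)))) ne with () ← ne refl

Δ122 : Tournament 5
Δ122 = record { adj = Δ122-adj ; irrefl = Δ-irrefl ; tourn = Δ-tourn }

-- T ∖ x : the subtournament induced on V(T) minus x (vertices re-indexed by punchIn x).
_∖_ : ∀ {m} → Tournament (suc m) → Fin (suc m) → Tournament m
T ∖ x = record
  { adj = λ a b → adj T (punchIn x a) (punchIn x b)
  ; irrefl = λ a → irrefl T (punchIn x a)
  ; tourn = λ a b ne → tourn T (punchIn x a) (punchIn x b) (λ e → ne (punchIn-injective x a b e))
  }

-- An ordering of the vertex set Fin m: position i (0-based) ↦ vertex v_{i+1}, a bijection.
record Ordering (m : ℕ) : Set where
  field
    σ     : Fin m → Fin m
    σ-inj : Injective _≡_ _≡_ σ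
    σ-sur : Surjective _≡_ _≡_ σ

open Ordering public

BEdge : ∀ {m} → Tournament m → Ordering m → Fin m → Fin m → Set
BEdge T o i j =
  (toℕ j < toℕ i × Arc T (σ o i) (σ o j)) ⊎ (toℕ i < toℕ j × Arc T (σ o j) (σ o i))

record IsPaving {m : ℕ} (T : Tournament m) (o : Ordering m) : Set where
  field
    consecutive : ∀ (i j : Fin m) → toℕ j ≡ suc (toℕ i) → ¬ BEdge T o i j
    atMostOneBefore : ∀ (i j k : Fin m) → toℕ j < toℕ i → toℕ k < toℕ i →
                      BEdge T o i j → BEdge T o i k → j ≡ k
    atMostOneAfter  : ∀ (i j k : Fin m) → toℕ i < toℕ j → toℕ i < toℕ k →
                      BEdge T o i j → BEdge T o i k → j ≡ k

{-# OPTIONS --safe #-}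
-- Let P(i) say that x has at most one out-neighbour among the positions < i, and Q(i) that it has
-- at most one in-neighbour among the positions ≥ i + 4. P(0) and Q(m − 1) hold vacuously, so it
-- suffices that Q(i) or P(i + 1) holds for every i. Otherwise there are out-neighbours p ≠ a at
-- positions ≤ i and in-neighbours b ≠ c at positions ≥ i + 4, and two of the vertices at positions
-- i + 1, i + 2, i + 3 lie on the same side of x: this gives four out-neighbours before two
-- in-neighbours, or two out-neighbours before four in-neighbours. In a paving ordering every vertex
-- has at most one B_σ-neighbour on each side, so two of the four have no B_σ-edge to either of the
-- other two vertices. All four arcs between the two pairs then go forward, and together with x the
-- pairs induce Δ(1,2,2).
module Submission where

open import Defs
open import Data.Nat using (ℕ; zero; suc; _≤_; _<_; _+_; z<s; s≤s; ≤-pred; _<?_; _≤?_)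
open import Data.Nat.Properties
  using (<⇒≤; ≤-trans; ≤-<-trans; <-≤-trans; +-monoʳ-<; m<m+n; +-cancelˡ-≡; suc-injective;
         m+1+n≰m)
open import Data.Fin using (Fin; suc; toℕ; punchIn; fromℕ<; splitAt; join)
open import Data.Fin.Patterns using (0F; 1F; 2F; 3F; 4F)
open import Data.Fin.Properties
  using (<⇒≢; punchIn-injective; punchInᵢ≢i; toℕ-injective; toℕ<n; toℕ-fromℕ<;
         fromℕ<-injective; join-splitAt; any?)
  renaming (_≟_ to _≟ᶠ_)
open import Data.Vec.Functional using (_++_; _∷_; [])
open import Data.Bool using (true; false; not)
open import Data.Bool.Properties using () renaming (_≟_ to _≟ᵇ_)
open import Data.Product using (Σ; ∃; _×_; _,_; proj₁; proj₂)
open import Data.Sum using (_⊎_; inj₁; inj₂; [_,_]; [_,_]′)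
open import Data.Empty using (⊥; ⊥-elim)
open import Function using (_∘_; id)
open import Function.Definitions using (Injective)
open import Relation.Nullary using (¬_; Dec; yes; no; ¬?)
open import Relation.Nullary.Decidable using (_×-dec_; decidable-stable)
open import Relation.Unary using (Decidable; _∩_; _⊆_; ∁)
open import Relation.Binary.PropositionalEquality using (_≡_; _≢_; refl; sym; trans; cong; subst)

private
  variable
    A C : Set
    P Q R : A → Set
    k l n : ℕ

AtMostOne : (A → Set) → Set
AtMostOne P = ∀ u v → P u → P v → u ≡ v

record Distinct {A : Set} (k : ℕ) (P : A → Set) : Set where
  field
    elem      : Fin k → A
    injective : Injective _≡_ _≡_ elem
    satisfies : ∀ i → P (elem i)

open Distinct

distinct₂ : (D : Distinct 2 P) → elem D 0F ≢ elem D 1F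
distinct₂ D e with () ← injective D e

pair : ∀ {u v} → u ≢ v → P u → P v → Distinct 2 P
pair {u = u} {v} u≢v pu pv = record
  { elem = u ∷ v ∷ [] ; injective = pair-injective ; satisfies = λ { 0F → pu ; 1F → pv } }
  where
  pair-injective : Injective _≡_ _≡_ (u ∷ v ∷ [])
  pair-injective {0F} {0F} _ = refl
  pair-injective {0F} {1F} e = ⊥-elim (u≢v e)
  pair-injective {1F} {0F} e = ⊥-elim (u≢v (sym e))
  pair-injective {1F} {1F} _ = refl

map : (g : A → C) → Injective _≡_ _≡_ g → (∀ {a} → P a → Q (g a)) →
      Distinct k P → Distinct k Q
map g g-injective g-P D = record
  { elem = g ∘ elem D ; injective = injective D ∘ g-injective ; satisfies = g-P ∘ satisfies D }

weaken : P ⊆ Q → Distinct k P → Distinct k Q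
weaken = map id id

refine : (D : Distinct k P) → (∀ i → Q (elem D i)) → Distinct k (P ∩ Q)
refine D Q-D = record
  { elem = elem D ; injective = injective D ; satisfies = λ i → satisfies D i , Q-D i }

omit : Fin (suc k) → Distinct (suc k) P → Distinct k P
omit i D = record
  { elem = elem D ∘ punchIn i
  ; injective = punchIn-injective i _ _ ∘ injective D
  ; satisfies = satisfies D ∘ punchIn i
  }

union : (D : Distinct k P) (E : Distinct l P) → (∀ i j → elem D i ≢ elem E j) → Distinct (k + l) P
union {k = k} {P = P} {l = l} D E D≢E = record
  { elem = elem D ++ elem E
  ; injective = splitAt-injective ∘ [D,E]-injective
  ; satisfies = [D,E]-satisfies ∘ splitAt k
  }
  where
  [D,E]-satisfies : ∀ s → P ([ elem D , elem E ]′ s)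
  [D,E]-satisfies (inj₁ i) = satisfies D i
  [D,E]-satisfies (inj₂ j) = satisfies E j

  [D,E]-injective : ∀ {s t} → [ elem D , elem E ]′ s ≡ [ elem D , elem E ]′ t → s ≡ t
  [D,E]-injective {inj₁ i} {inj₁ j} e = cong inj₁ (injective D e)
  [D,E]-injective {inj₁ i} {inj₂ j} e = ⊥-elim (D≢E i j e)
  [D,E]-injective {inj₂ i} {inj₁ j} e = ⊥-elim (D≢E j i (sym e))
  [D,E]-injective {inj₂ i} {inj₂ j} e = cong inj₂ (injective E e)

  splitAt-injective : ∀ {i j} → splitAt k i ≡ splitAt k j → i ≡ j
  splitAt-injective {i} {j} e =
    trans (sym (join-splitAt k l i)) (trans (cong (join k l) e) (join-splitAt k l j))

avoid-one : Decidable Q → AtMostOne Q → Distinct (suc k) P → Distinct k (P ∩ ∁ Q)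
avoid-one Q? Q-unique D with any? (Q? ∘ elem D)
... | yes (i , Qi) =
  refine (omit i D) λ j Qj → punchInᵢ≢i i j (injective D (Q-unique _ _ Qj Qi))
... | no ¬Q = refine (omit 0F D) λ j Qj → ¬Q (suc j , Qj)

avoid : (Q : Fin n → A → Set) → (∀ b → Decidable (Q b)) → (∀ b → AtMostOne (Q b)) →
        Distinct (n + k) P → Distinct k (P ∩ λ a → ∀ b → ¬ Q b a)
avoid {n = zero} Q Q? Q-unique D = refine D λ _ ()
avoid {n = suc n} Q Q? Q-unique D =
  weaken (λ ((Pa , ¬Q₀a) , ¬Qₛa) → Pa , λ { 0F → ¬Q₀a ; (suc b) → ¬Qₛa b })
         (avoid (Q ∘ suc) (Q? ∘ suc) (Q-unique ∘ suc) (avoid-one (Q? 0F) (Q-unique 0F) D))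

pigeonhole₃ : (∀ a → Q a ⊎ R a) → Distinct 3 P → Distinct 2 (P ∩ Q) ⊎ Distinct 2 (P ∩ R)
pigeonhole₃ Q⊎R D with Q⊎R (elem D 0F) | Q⊎R (elem D 1F) | Q⊎R (elem D 2F)
... | inj₁ q₀ | inj₁ q₁ | _       = inj₁ (refine (omit 2F D) λ { 0F → q₀ ; 1F → q₁ })
... | inj₂ r₀ | inj₂ r₁ | _       = inj₂ (refine (omit 2F D) λ { 0F → r₀ ; 1F → r₁ })
... | inj₁ q₀ | inj₂ _  | inj₁ q₂ = inj₁ (refine (omit 1F D) λ { 0F → q₀ ; 1F → q₂ })
... | inj₂ r₀ | inj₁ _  | inj₂ r₂ = inj₂ (refine (omit 1F D) λ { 0F → r₀ ; 1F → r₂ })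
... | inj₁ _  | inj₂ r₁ | inj₂ r₂ = inj₂ (refine (omit 0F D) λ { 0F → r₁ ; 1F → r₂ })
... | inj₂ _  | inj₁ q₁ | inj₁ q₂ = inj₁ (refine (omit 0F D) λ { 0F → q₁ ; 1F → q₂ })

atMostOne⊎distinct₂ : {P : Fin n → Set} → Decidable P → AtMostOne P ⊎ Distinct 2 P
atMostOne⊎distinct₂ P? with any? (λ u → any? λ v → ¬? (u ≟ᶠ v) ×-dec P? u ×-dec P? v)
... | yes (u , v , u≢v , Pu , Pv) = inj₂ (pair u≢v Pu Pv)
... | no ¬two =
  inj₁ λ u v Pu Pv → decidable-stable (u ≟ᶠ v) λ u≢v → ¬two (u , v , u≢v , Pu , Pv)

Window : ℕ → Fin n → Set
Window i u = i < toℕ u × toℕ u < i + 4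

window : ∀ i → i + 4 ≤ n → Distinct 3 (Window {n} i)
window {n} i i+4≤n = record
  { elem = λ k → fromℕ< (offset<n k)
  ; injective = λ {k} {k′} e → toℕ-injective (suc-injective (+-cancelˡ-≡ i _ _
      (fromℕ<-injective _ _ (offset<n k) (offset<n k′) e)))
  ; satisfies = λ k →
      subst (λ p → i < p × p < i + 4) (sym (toℕ-fromℕ< (offset<n k))) (m<m+n i z<s , offset<4 k)
  }
  where
  offset<4 : ∀ (k : Fin 3) → i + suc (toℕ k) < i + 4
  offset<4 k = +-monoʳ-< i (s≤s (toℕ<n k))

  offset<n : ∀ (k : Fin 3) → i + suc (toℕ k) < n
  offset<n k = <-≤-trans (offset<4 k) i+4≤n

crossing-point : ∀ {P Q : ℕ → Set} n → P 0 → Q n → (∀ i → Q i ⊎ P (suc i)) →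
                 ∃ λ (i : Fin (suc n)) → P (toℕ i) × Q (toℕ i)
crossing-point zero P₀ Q₀ _ = 0F , P₀ , Q₀
crossing-point {P} {Q} (suc n) P₀ Qₙ step with step 0
... | inj₁ Q₀ = 0F , P₀ , Q₀
... | inj₂ P₁ with crossing-point {P ∘ suc} {Q ∘ suc} n P₁ Qₙ (step ∘ suc)
...   | i , Pᵢ , Qᵢ = suc i , Pᵢ , Qᵢ

module _ (T : Tournament n) where

  arc-asym : ∀ {u v} → Arc T u v → adj T v u ≡ false
  arc-asym {u} {v} uv with u ≟ᶠ v
  ... | yes refl = irrefl T u
  ... | no u≢v = trans (tourn T v u (u≢v ∘ sym)) (cong not uv)

  arc-or-arc : ∀ {u v} → u ≢ v → Arc T u v ⊎ Arc T v u
  arc-or-arc {u} {v} u≢v with adj T u v in uv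
  ... | true = inj₁ refl
  ... | false = inj₂ (trans (tourn T v u (u≢v ∘ sym)) (cong not uv))

module _ {S : Tournament k} {T : Tournament n} {g : Fin k → Fin n}
         (g-arc : ∀ {a b} → Arc S a b → Arc T (g a) (g b)) where

  arc-preserving⇒adj-preserving : ∀ a b → adj T (g a) (g b) ≡ adj S a b
  arc-preserving⇒adj-preserving a b with a ≟ᶠ b
  ... | yes refl = trans (irrefl T (g a)) (sym (irrefl S a))
  ... | no a≢b with adj S a b in ab
  ...   | true = g-arc ab
  ...   | false = arc-asym T (g-arc (trans (tourn S b a (a≢b ∘ sym)) (cong not ab)))

  arc-preserving⇒injective : Injective _≡_ _≡_ g
  arc-preserving⇒injective {a} {b} ga≡gb with a ≟ᶠ b
  ... | yes a≡b = a≡b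
  ... | no a≢b = ⊥-elim ([ no-loop ga≡gb , no-loop (sym ga≡gb) ] (arc-or-arc S a≢b))
    where
    no-loop : ∀ {u v} → g u ≡ g v → ¬ Arc S u v
    no-loop {u} gu≡gv uv
      with () ← trans (sym (subst (Arc T (g u)) (sym gu≡gv) (g-arc uv))) (irrefl T (g u))

  arc-preserving-embedding : Embedding S T
  arc-preserving-embedding = record
    { f = g ; f-inj = arc-preserving⇒injective ; f-adj = arc-preserving⇒adj-preserving }

module _ (T : Tournament n) where

  Δ122-embedding : ∀ {x y₁ y₂ z₁ z₂} →
    Arc T x y₁ → Arc T x y₂ → Arc T y₁ y₂ →
    Arc T y₁ z₁ → Arc T y₁ z₂ → Arc T y₂ z₁ → Arc T y₂ z₂ →
    Arc T z₁ z₂ → Arc T z₁ x → Arc T z₂ x → Embedding Δ122 T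
  Δ122-embedding {x} {y₁} {y₂} {z₁} {z₂} xy₁ xy₂ y₁y₂ y₁z₁ y₁z₂ y₂z₁ y₂z₂ z₁z₂ z₁x z₂x =
    arc-preserving-embedding {g = g} arcs
    where
    g : Fin 5 → Fin n
    g = x ∷ y₁ ∷ y₂ ∷ z₁ ∷ z₂ ∷ []

    arcs : ∀ {a b} → Arc Δ122 a b → Arc T (g a) (g b)
    arcs {0F} {1F} _ = xy₁
    arcs {0F} {2F} _ = xy₂
    arcs {1F} {2F} _ = y₁y₂
    arcs {1F} {3F} _ = y₁z₁
    arcs {1F} {4F} _ = y₁z₂
    arcs {2F} {3F} _ = y₂z₁
    arcs {2F} {4F} _ = y₂z₂
    arcs {3F} {4F} _ = z₁z₂
    arcs {3F} {0F} _ = z₁x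
    arcs {4F} {0F} _ = z₂x
    arcs {0F} {0F} ()
    arcs {0F} {3F} ()
    arcs {0F} {4F} ()
    arcs {1F} {0F} ()
    arcs {1F} {1F} ()
    arcs {2F} {0F} ()
    arcs {2F} {1F} ()
    arcs {2F} {2F} ()
    arcs {3F} {1F} ()
    arcs {3F} {2F} ()
    arcs {3F} {3F} ()
    arcs {4F} {1F} ()
    arcs {4F} {2F} ()
    arcs {4F} {3F} ()
    arcs {4F} {4F} ()

  Δ122-embedding-from-pairs : ∀ {x} (Y : Distinct 2 (Arc T x)) (Z : Distinct 2 (λ z → Arc T z x)) →
                              (∀ a b → Arc T (elem Y a) (elem Z b)) → Embedding Δ122 T
  Δ122-embedding-from-pairs Y Z YZ =
    oriented (arc-or-arc T (distinct₂ Y)) (arc-or-arc T (distinct₂ Z))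
    where
    oriented : Arc T (elem Y 0F) (elem Y 1F) ⊎ Arc T (elem Y 1F) (elem Y 0F) →
               Arc T (elem Z 0F) (elem Z 1F) ⊎ Arc T (elem Z 1F) (elem Z 0F) → Embedding Δ122 T
    oriented (inj₁ y₀y₁) (inj₁ z₀z₁) = Δ122-embedding (satisfies Y 0F) (satisfies Y 1F) y₀y₁
      (YZ 0F 0F) (YZ 0F 1F) (YZ 1F 0F) (YZ 1F 1F) z₀z₁ (satisfies Z 0F) (satisfies Z 1F)
    oriented (inj₁ y₀y₁) (inj₂ z₁z₀) = Δ122-embedding (satisfies Y 0F) (satisfies Y 1F) y₀y₁
      (YZ 0F 1F) (YZ 0F 0F) (YZ 1F 1F) (YZ 1F 0F) z₁z₀ (satisfies Z 1F) (satisfies Z 0F)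
    oriented (inj₂ y₁y₀) (inj₁ z₀z₁) = Δ122-embedding (satisfies Y 1F) (satisfies Y 0F) y₁y₀
      (YZ 1F 0F) (YZ 1F 1F) (YZ 0F 0F) (YZ 0F 1F) z₀z₁ (satisfies Z 0F) (satisfies Z 1F)
    oriented (inj₂ y₁y₀) (inj₂ z₁z₀) = Δ122-embedding (satisfies Y 1F) (satisfies Y 0F) y₁y₀
      (YZ 1F 1F) (YZ 1F 0F) (YZ 0F 1F) (YZ 0F 0F) z₁z₀ (satisfies Z 1F) (satisfies Z 0F)

module _ (S : Tournament n) (o : Ordering n) where

  BEdge< : Fin n → Fin n → Set
  BEdge< j k = toℕ j < toℕ k × Arc S (σ o k) (σ o j)

  BEdge<? : ∀ j k → Dec (BEdge< j k)
  BEdge<? j k = (toℕ j <? toℕ k) ×-dec (adj S (σ o k) (σ o j) ≟ᵇ true)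

  ¬BEdge<⇒arc : ∀ {j k} → toℕ j < toℕ k → ¬ BEdge< j k → Arc S (σ o j) (σ o k)
  ¬BEdge<⇒arc j<k ¬jk with arc-or-arc S (<⇒≢ j<k ∘ σ-inj o)
  ... | inj₁ jk = jk
  ... | inj₂ kj = ⊥-elim (¬jk (j<k , kj))

  module _ (paving : IsPaving S o) where

    earlier-neighbour-unique : ∀ k → AtMostOne (λ j → BEdge< j k)
    earlier-neighbour-unique k j j′ (j<k , kj) (j′<k , kj′) =
      IsPaving.atMostOneBefore paving k j j′ j<k j′<k (inj₁ (j<k , kj)) (inj₁ (j′<k , kj′))

    later-neighbour-unique : ∀ j → AtMostOne (BEdge< j)
    later-neighbour-unique j k k′ (j<k , kj) (j<k′ , k′j) =
      IsPaving.atMostOneAfter paving j k k′ j<k j<k′ (inj₂ (j<k , kj)) (inj₂ (j<k′ , k′j))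

module _ (T : Tournament (suc n)) (x : Fin (suc n)) (o : Ordering n) where

  vertex : Fin n → Fin (suc n)
  vertex j = punchIn x (σ o j)

  vertex-injective : Injective _≡_ _≡_ vertex
  vertex-injective = σ-inj o ∘ punchIn-injective x _ _

  Out In : Fin n → Set
  Out j = Arc T x (vertex j)
  In j = Arc T (vertex j) x

  out-or-in : ∀ j → Out j ⊎ In j
  out-or-in j = arc-or-arc T (punchInᵢ≢i x (σ o j) ∘ sym)

  OutBelow InFrom : ℕ → Fin n → Set
  OutBelow i j = toℕ j < i × Out j
  InFrom i j = i ≤ toℕ j × In j

  OutBelow? : ∀ i → Decidable (OutBelow i)
  OutBelow? i j = (toℕ j <? i) ×-dec (adj T x (vertex j) ≟ᵇ true)

  InFrom? : ∀ i → Decidable (InFrom i)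
  InFrom? i j = (i ≤? toℕ j) ×-dec (adj T (vertex j) x ≟ᵇ true)

  module _ (Δ122-free : Free Δ122 T) (paving : IsPaving (T ∖ x) o) where

    no-separated-out₂-in₂ : ∀ {i} (Y : Distinct 2 (OutBelow i)) (Z : Distinct 2 (InFrom i)) →
      (∀ a b → ¬ BEdge< (T ∖ x) o (elem Y a) (elem Z b)) → ⊥
    no-separated-out₂-in₂ Y Z no-BEdge =
      Δ122-free (Δ122-embedding-from-pairs T
        (map vertex vertex-injective proj₂ Y) (map vertex vertex-injective proj₂ Z)
        λ a b → ¬BEdge<⇒arc (T ∖ x) o
                  (<-≤-trans (proj₁ (satisfies Y a)) (proj₁ (satisfies Z b))) (no-BEdge a b))

    no-separated-out₄-in₂ : ∀ {i} → Distinct 4 (OutBelow i) → Distinct 2 (InFrom i) → ⊥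
    no-separated-out₄-in₂ {i} Y Z =
      no-separated-out₂-in₂ (weaken proj₁ Y′) Z λ a b → proj₂ (satisfies Y′ a) b
      where
      Y′ : Distinct 2 (OutBelow i ∩ λ y → ∀ b → ¬ BEdge< (T ∖ x) o y (elem Z b))
      Y′ = avoid (λ b y → BEdge< (T ∖ x) o y (elem Z b)) (λ b y → BEdge<? (T ∖ x) o y (elem Z b))
                 (λ b → earlier-neighbour-unique (T ∖ x) o paving (elem Z b)) Y

    no-separated-out₂-in₄ : ∀ {i} → Distinct 2 (OutBelow i) → Distinct 4 (InFrom i) → ⊥
    no-separated-out₂-in₄ {i} Y Z =
      no-separated-out₂-in₂ Y (weaken proj₁ Z′) λ a b → proj₂ (satisfies Z′ b) a
      where
      Z′ : Distinct 2 (InFrom i ∩ λ z → ∀ a → ¬ BEdge< (T ∖ x) o (elem Y a) z)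
      Z′ = avoid (λ a → BEdge< (T ∖ x) o (elem Y a)) (λ a → BEdge<? (T ∖ x) o (elem Y a))
                 (λ a → later-neighbour-unique (T ∖ x) o paving (elem Y a)) Z

    no-crossing-pairs : ∀ i → Distinct 2 (OutBelow (suc i)) → Distinct 2 (InFrom (i + 4)) → ⊥
    no-crossing-pairs i Y Z = [ out-pair , in-pair ] (pigeonhole₃ out-or-in (window i i+4≤n))
      where
      i<i+4 : i < i + 4
      i<i+4 = m<m+n i z<s

      i+4≤n : i + 4 ≤ n
      i+4≤n = <⇒≤ (≤-<-trans (proj₁ (satisfies Z 0F)) (toℕ<n (elem Z 0F)))

      out-pair : Distinct 2 (Window i ∩ Out) → ⊥
      out-pair U = no-separated-out₄-in₂
        (union (weaken (λ (y<1+i , xy) → <-≤-trans y<1+i i<i+4 , xy) Y)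
               (weaken (λ ((_ , u<i+4) , xu) → u<i+4 , xu) U)
               λ a b → <⇒≢ (<-≤-trans (proj₁ (satisfies Y a)) (proj₁ (proj₁ (satisfies U b)))))
        Z

      in-pair : Distinct 2 (Window i ∩ In) → ⊥
      in-pair U = no-separated-out₂-in₄ Y
        (union (weaken (λ ((i<u , _) , ux) → i<u , ux) U)
               (weaken (λ (i+4≤z , zx) → <-≤-trans i<i+4 i+4≤z , zx) Z)
               λ a b → <⇒≢ (<-≤-trans (proj₂ (proj₁ (satisfies U a))) (proj₁ (satisfies Z b))))

    atMostOne-InFrom⊎OutBelow : ∀ i → AtMostOne (InFrom (i + 4)) ⊎ AtMostOne (OutBelow (suc i))
    atMostOne-InFrom⊎OutBelow i
      with atMostOne⊎distinct₂ (InFrom? (i + 4)) | atMostOne⊎distinct₂ (OutBelow? (suc i))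
    ... | inj₁ in-unique | _               = inj₁ in-unique
    ... | inj₂ _         | inj₁ out-unique = inj₂ out-unique
    ... | inj₂ Z         | inj₂ Y          = ⊥-elim (no-crossing-pairs i Y Z)

-- The hypothesis 5 ≤ suc m is used only to exclude m = 0.
lemma5p2 : (m : ℕ) → 5 ≤ suc m → (T : Tournament (suc m)) → Free Δ122 T →
    (x : Fin (suc m)) → (o : Ordering m) → IsPaving (T ∖ x) o →
    Σ (Fin m) λ i →
      (∀ (j k : Fin m) → toℕ j < toℕ i → toℕ k < toℕ i →
        Arc T x (punchIn x (σ o j)) → Arc T x (punchIn x (σ o k)) → j ≡ k)
      × (∀ (j k : Fin m) → toℕ i + 4 ≤ toℕ j → toℕ i + 4 ≤ toℕ k →
        Arc T (punchIn x (σ o j)) x → Arc T (punchIn x (σ o k)) x → j ≡ k)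
lemma5p2 zero (s≤s ()) T Δ122-free x o paving
lemma5p2 (suc m) _ T Δ122-free x o paving =
  let i , out-unique , in-unique =
        crossing-point {λ i → AtMostOne (OutBelow T x o i)}
                       {λ i → AtMostOne (InFrom T x o (i + 4))}
          m none-below-0 none-from-m+4 (atMostOne-InFrom⊎OutBelow T x o Δ122-free paving)
  in i , (λ j k j<i k<i xj xk → out-unique j k (j<i , xj) (k<i , xk))
       , (λ j k i+4≤j i+4≤k jx kx → in-unique j k (i+4≤j , jx) (i+4≤k , kx))
  where
  none-below-0 : AtMostOne (OutBelow T x o 0)
  none-below-0 _ _ (() , _)

  none-from-m+4 : AtMostOne (InFrom T x o (m + 4))
  none-from-m+4 j _ (m+4≤j , _) _ = ⊥-elim (m+1+n≰m m (≤-trans m+4≤j (≤-pred (toℕ<n j))))
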